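{- Let $(L_n)_{n\ge 0}$ be the Lucas sequence and $\Phi=\frac{1+\sqrt5}{2}$. For a natural number $n$, a non-consecutive partition of $n$ is a finite set $I\subseteq\{0,1,2,\ldots\}$ with no two elements consecutive integers and $\sum_{i\in I}L_i=n$ (with $L_0$ and $L_2$ allowed to appear simultaneously). Let $c(N)$ be the number of natural numbers $n\le N$ having more than one non-consecutive partition. Then $$\lim_{N\to\infty}\frac{c(N)}{N}=\frac{1}{3\Phi+1}.$$
   Context: The Lucas sequence is defined by $L_0=2$, $L_1=1$, and $L_n=L_{n-1}+L_{n-2}$ for $n\ge 2$. -}

module Defs where

open import Data.Nat using (ℕ; zero; suc; _+_; _≤_)
open import Data.List using (List; []; _∷_; map; length)
open import Data.Nat.ListAction using (sum)
open import Data.List.Membership.Propositional using (_∈_)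
open import Data.List.Relation.Unary.Unique.Propositional using (Unique)
open import Data.Product using (Σ; _×_; ∃-syntax)
open import Relation.Binary.PropositionalEquality using (_≡_; _≢_)
open import Function.Bundles using (_⇔_)
open import Data.Integer using (+_)
open import Data.Rational using (ℚ; _/_; _+_; _*_; _<_; 0ℚ)

L : ℕ → ℕ
L zero = 2
L (suc zero) = 1
L (suc (suc n)) = L (suc n) Data.Nat.+ L n

-- A finite subset of ℕ is represented by the unique strictly increasing
-- list of its elements.
data NonConsec : List ℕ → Set where
  nc-[]  : NonConsec []
  nc-[_] : ∀ x → NonConsec (x ∷ [])
  nc-∷   : ∀ {x y I} → 2 Data.Nat.+ x ≤ y → NonConsec (y ∷ I) → NonConsec (x ∷ y ∷ I)

NCPartition : ℕ → List ℕ → Set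
NCPartition n I = NonConsec I × sum (map L I) ≡ n

MultiPart : ℕ → Set
MultiPart n = ∃[ I ] ∃[ J ] (NCPartition n I × NCPartition n J × I ≢ J)

-- S lists, without repetition, exactly the n ≤ N having more than one
-- non-consecutive partition; hence length S = c(N).
Enumerates : ℕ → List ℕ → Set
Enumerates N S = Unique S × (∀ n → (n ∈ S) ⇔ (n ≤ N × MultiPart n))

-- The target value x = 1/(3Φ+1) = (3√5 - 5)/10, described by its Dedekind cut:
-- q < x  iff  10q+5 < 3√5  iff  10q+5 < 0 or (10q+5)² < 45
-- x < q  iff  10q+5 > 0 and (10q+5)² > 45
shift : ℚ → ℚ
shift q = ((+ 10 / 1) * q) Data.Rational.+ (+ 5 / 1)

BelowTarget : ℚ → Set
BelowTarget q = (shift q < 0ℚ) Data.Sum.⊎ (shift q * shift q < + 45 / 1)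
  where import Data.Sum

AboveTarget : ℚ → Set
AboveTarget q = (0ℚ < shift q) × (+ 45 / 1 < shift q * shift q)

-- A non-consecutive partition of n is unique unless it contains both 0 and 2: a non-consecutive
-- sum without that pair lies below the Lucas number following its largest index (when that index
-- is positive), so the largest index is determined by the sum.  As L 0 + L 2 = L 1 + L 3, the
-- numbers with two partitions are exactly 5 + y, where y is a non-consecutive sum of Lucas
-- numbers of index at least 4.  These y are counted through the greedy split x = L (m + 1) + w,
-- 0 < w ≤ L m: their number below x is G (m + 1) + (their number below w), where G k, their
-- number below L k, is a Fibonacci sequence with L k = 3 G (k - 1) + 4 G k.  Cassini's identity
-- turns into L k ² − 5 G k (G k + L k) = ±9, so G k / L k tends to the root 1/(3Φ + 1) of
-- 5ρ(ρ + 1) = 1 from alternating sides; a bound on the ratio at two consecutive indices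
-- persists, and along the greedy split it bounds the count below any x up to an additive constant.

module Submission where

open import Defs
open import Data.Nat using (ℕ; zero; suc; _+_; _*_; _∸_; _≤_; _<_; z≤n; s≤s; _≤?_; _<?_)
open import Data.Nat.Properties
open import Data.Nat.ListAction using (sum)
open import Data.Nat.ListAction.Properties using (sum-++)
open import Data.List using (List; []; _∷_; map; length; _∷ʳ_; _++_)
import Data.List.Properties as List
open import Data.List.Reverse using (Reverse; []; _∶_∶ʳ_; reverseView)
open import Data.List.Relation.Unary.All as All using (All; []; _∷_)
open import Data.List.Relation.Unary.All.Properties using (∷ʳ⁺; ∷ʳ⁻)
open import Data.List.Relation.Unary.Any using (here; there)
open import Data.List.Relation.Unary.AllPairs using ([]; _∷_)
open import Data.List.Membership.Propositional using (_∈_)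
open import Data.List.Membership.Propositional.Properties using (∈-∃++; ∈-++⁻; ∈-++⁺ˡ; ∈-++⁺ʳ; ∈-map⁺; ∈-map⁻)
open import Data.List.Relation.Unary.Unique.Propositional using (Unique)
import Data.List.Relation.Unary.Unique.Propositional.Properties as Unique
open import Data.Nat.Induction using (<-rec)
open import Data.Nat.Tactic.RingSolver using (solve-∀)
open import Data.Product using (Σ; _×_; _,_; proj₁; proj₂; ∃-syntax)
open import Data.Sum using (inj₁; inj₂)
open import Data.Empty using (⊥)
open import Relation.Nullary using (¬_; Dec; yes; no; contradiction)
open import Relation.Binary.Definitions using (tri<; tri≈; tri>)
open import Relation.Binary.PropositionalEquality
open import Function.Base using (_∘_)
open import Data.Integer as ℤ using (ℤ; -[1+_]; +<+; -<+)
import Data.Integer.Properties as ℤ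
import Data.Integer.Tactic.RingSolver as ℤ
open import Data.Rational as ℚ using (ℚ; mkℚ; _/_; toℚᵘ; 0ℚ; ↥_; ↧_; ↧ₙ_)
open import Data.Rational.Properties using (toℚᵘ-homo-+; toℚᵘ-homo-*; toℚᵘ-mono-<; toℚᵘ-cancel-<; toℚᵘ-fromℚᵘ)
open import Data.Rational.Unnormalised as ℚᵘ using (ℚᵘ; mkℚᵘ; *≡*; *<*)
import Data.Rational.Unnormalised.Properties as ℚᵘ
open import Function.Bundles using (_⇔_; mk⇔; Equivalence)

-- Lucas numbers and non-consecutive sums

1≤L : ∀ n → 1 ≤ L n
1≤L zero = s≤s z≤n
1≤L (suc zero) = s≤s z≤n
1≤L (suc (suc n)) = ≤-trans (1≤L (suc n)) (m≤m+n _ _)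

n≤L : ∀ n → n ≤ L n
n≤L zero = z≤n
n≤L (suc zero) = ≤-refl
n≤L (suc (suc n)) = subst (_≤ L (suc (suc n))) (+-comm (suc n) 1) (+-mono-≤ (n≤L (suc n)) (1≤L n))

L-<-suc : ∀ {n} → 1 ≤ n → L n < L (suc n)
L-<-suc {suc n} _ = m<m+n (L (suc n)) (1≤L n)

L-mono-< : ∀ {i j} → 1 ≤ i → i < j → L i < L j
L-mono-< {i} {suc j} 1≤i (s≤s i≤j) with m≤n⇒m<n∨m≡n i≤j
... | inj₁ i<j = <-trans (L-mono-< 1≤i i<j) (L-<-suc (≤-trans 1≤i (<⇒≤ i<j)))
... | inj₂ refl = L-<-suc 1≤i

L-mono-≤ : ∀ {i j} → 1 ≤ i → i ≤ j → L i ≤ L j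
L-mono-≤ 1≤i i≤j with m≤n⇒m<n∨m≡n i≤j
... | inj₁ i<j = <⇒≤ (L-mono-< 1≤i i<j)
... | inj₂ refl = ≤-refl

L-cancel-< : ∀ {i j} → 1 ≤ j → L i < L j → i < j
L-cancel-< {i} {j} 1≤j Li<Lj with i <? j
... | yes i<j = i<j
... | no i≮j = contradiction (L-mono-≤ 1≤j (≮⇒≥ i≮j)) (<⇒≱ Li<Lj)

7≤L : ∀ {k} → 4 ≤ k → 7 ≤ L k
7≤L = L-mono-≤ (s≤s z≤n)

lucasSum : List ℕ → ℕ
lucasSum K = sum (map L K)

lucasSum-∷ʳ : ∀ K m → lucasSum (K ∷ʳ m) ≡ lucasSum K + L m
lucasSum-∷ʳ K m = begin
  sum (map L (K ∷ʳ m))       ≡⟨ cong sum (List.map-++ L K (m ∷ [])) ⟩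
  sum (map L K ++ L m ∷ [])  ≡⟨ sum-++ (map L K) (L m ∷ []) ⟩
  lucasSum K + (L m + 0)     ≡⟨ cong (lucasSum K +_) (+-identityʳ (L m)) ⟩
  lucasSum K + L m           ∎
  where open ≡-Reasoning

L≤lucasSum : ∀ K → All (λ e → L e ≤ lucasSum K) K
L≤lucasSum [] = []
L≤lucasSum (x ∷ K) = m≤m+n (L x) _ ∷ All.map (λ Le≤ → ≤-trans Le≤ (m≤n+m _ (L x))) (L≤lucasSum K)

L≤lucasSum-∷ʳ : ∀ K m → L m ≤ lucasSum (K ∷ʳ m)
L≤lucasSum-∷ʳ K m = proj₂ (∷ʳ⁻ (L≤lucasSum (K ∷ʳ m)))

nc-tail : ∀ {x K} → NonConsec (x ∷ K) → NonConsec K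
nc-tail nc-[ _ ] = nc-[]
nc-tail (nc-∷ _ nc) = nc

nc-gaps : ∀ {x K} → NonConsec (x ∷ K) → All (λ e → 2 + x ≤ e) K
nc-gaps nc-[ _ ] = []
nc-gaps (nc-∷ {y = y} x+2≤y nc) = x+2≤y ∷ All.map (≤-trans x+2≤y ∘ ≤-trans (m≤n+m y 2)) (nc-gaps nc)

nc-lower : ∀ {m x K} → m ≤ x → NonConsec (x ∷ K) → All (m ≤_) (x ∷ K)
nc-lower {x = x} m≤x nc = m≤x ∷ All.map (≤-trans (≤-trans m≤x (m≤n+m x 2))) (nc-gaps nc)

nc-∷⁺ : ∀ {x K} → NonConsec K → All (λ e → 2 + x ≤ e) K → NonConsec (x ∷ K)
nc-∷⁺ {x} nc-[] [] = nc-[ x ]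
nc-∷⁺ nc-[ _ ] (x+2≤y ∷ []) = nc-∷ x+2≤y nc-[ _ ]
nc-∷⁺ nc@(nc-∷ _ _) (x+2≤y ∷ _) = nc-∷ x+2≤y nc

nc-∷ʳ⁺ : ∀ {K m} → NonConsec K → All (λ e → 2 + e ≤ m) K → NonConsec (K ∷ʳ m)
nc-∷ʳ⁺ {m = m} nc-[] [] = nc-[ m ]
nc-∷ʳ⁺ {m = m} nc-[ _ ] (p ∷ []) = nc-∷ p nc-[ m ]
nc-∷ʳ⁺ (nc-∷ x+2≤y nc) (_ ∷ ps) = nc-∷ x+2≤y (nc-∷ʳ⁺ nc ps)

nc-∷ʳ⁻ : ∀ K {m} → NonConsec (K ∷ʳ m) → NonConsec K × All (λ e → 2 + e ≤ m) K
nc-∷ʳ⁻ [] _ = nc-[] , []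
nc-∷ʳ⁻ (x ∷ []) (nc-∷ x+2≤m _) = nc-[ x ] , x+2≤m ∷ []
nc-∷ʳ⁻ (x ∷ y ∷ K) (nc-∷ x+2≤y nc) with nc-∷ʳ⁻ (y ∷ K) nc
... | ncK , gaps@(y+2≤m ∷ _) = nc-∷ x+2≤y ncK , ≤-trans x+2≤y (≤-trans (m≤n+m y 2) y+2≤m) ∷ gaps

nc-∷ʳ-< : ∀ K {m} → NonConsec (K ∷ʳ m) → All (_< suc m) (K ∷ʳ m)
nc-∷ʳ-< K {m} nc = ∷ʳ⁺ (All.map (λ {e} e+2≤m → s≤s (≤-trans (m≤n+m e 2) e+2≤m)) (proj₂ (nc-∷ʳ⁻ K nc))) ≤-refl

gaps≤1⇒[] : ∀ {a} K → a ≤ 1 → All (λ e → 2 + e ≤ a) K → K ≡ []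
gaps≤1⇒[] [] _ _ = refl
gaps≤1⇒[] (_ ∷ _) a≤1 (e+2≤a ∷ _) = contradiction (≤-trans e+2≤a a≤1) λ { (s≤s ()) }

L+lucasSum≤ : ∀ {m hi} K → 1 ≤ m → m ≤ hi → NonConsec K → All (m <_) K → All (_< hi) K →
              L m + lucasSum K ≤ L hi
L+lucasSum≤ [] 1≤m m≤hi _ _ _ = ≤-trans (≤-reflexive (+-identityʳ _)) (L-mono-≤ 1≤m m≤hi)
L+lucasSum≤ (zero ∷ _) _ _ _ (() ∷ _) _
L+lucasSum≤ {m} {hi} (suc e ∷ K) 1≤m _ nc (m<e ∷ _) (e<hi ∷ hs) = begin
  L m + (L (suc e) + lucasSum K)  ≤⟨ +-monoˡ-≤ _ (L-mono-≤ 1≤m (≤-pred m<e)) ⟩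
  L e + (L (suc e) + lucasSum K)  ≡⟨ sym (+-assoc (L e) _ _) ⟩
  L e + L (suc e) + lucasSum K    ≡⟨ cong (_+ lucasSum K) (+-comm (L e) _) ⟩
  L (suc (suc e)) + lucasSum K    ≤⟨ L+lucasSum≤ K (s≤s z≤n) e<hi (nc-tail nc) (nc-gaps nc) hs ⟩
  L hi                            ∎
  where open ≤-Reasoning

-- Uniqueness of non-consecutive partitions

data Opens02 : List ℕ → Set where
  opens02 : ∀ K → Opens02 (0 ∷ 2 ∷ K)

opens02? : ∀ K → Dec (Opens02 K)
opens02? [] = no λ ()
opens02? (suc _ ∷ _) = no λ ()
opens02? (0 ∷ []) = no λ ()
opens02? (0 ∷ 0 ∷ _) = no λ ()
opens02? (0 ∷ 1 ∷ _) = no λ ()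
opens02? (0 ∷ 2 ∷ K) = yes (opens02 K)
opens02? (0 ∷ suc (suc (suc _)) ∷ _) = no λ ()

opens02-∷ʳ : ∀ {K} a → Opens02 K → Opens02 (K ∷ʳ a)
opens02-∷ʳ a (opens02 K) = opens02 (K ∷ʳ a)

-- Both exclusions are needed: L 0 + L 2 = 5 > L 3, and L 0 > L 1.
lucasSum-< : ∀ {hi} K → 2 ≤ hi → NonConsec K → ¬ Opens02 K → All (_< hi) K → lucasSum K < L hi
lucasSum-< {hi} [] _ _ _ _ = 1≤L hi
lucasSum-< (0 ∷ []) 2≤hi _ _ _ = L-mono-≤ (s≤s z≤n) 2≤hi
lucasSum-< (0 ∷ 0 ∷ _) _ (nc-∷ () _) _ _
lucasSum-< (0 ∷ 1 ∷ _) _ (nc-∷ (s≤s ()) _) _ _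
lucasSum-< (0 ∷ 2 ∷ K) _ _ ¬o _ = contradiction (opens02 K) ¬o
lucasSum-< (0 ∷ suc (suc (suc e)) ∷ K) 2≤hi nc _ (_ ∷ hs) =
  L+lucasSum≤ (suc (suc (suc e)) ∷ K) (s≤s z≤n) 2≤hi (nc-tail nc) (nc-lower (s≤s (s≤s (s≤s z≤n))) (nc-tail nc)) hs
lucasSum-< (1 ∷ K) 2≤hi nc _ (_ ∷ hs) =
  ≤-trans (n≤1+n _) (L+lucasSum≤ K (s≤s z≤n) 2≤hi (nc-tail nc) (nc-gaps nc) hs)
lucasSum-< K@(suc (suc _) ∷ _) 2≤hi nc _ hs =
  L+lucasSum≤ K ≤-refl (≤-trans (s≤s z≤n) 2≤hi) nc (nc-lower (s≤s (s≤s z≤n)) nc) hs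

high⇒¬opens02 : ∀ {m K} → All (suc m ≤_) K → ¬ Opens02 K
high⇒¬opens02 (() ∷ _) (opens02 _)

last<⇒lucasSum≢ : ∀ I a J b → a < b → NonConsec (I ∷ʳ a) → ¬ Opens02 (I ∷ʳ a) → NonConsec (J ∷ʳ b) →
                  lucasSum (I ∷ʳ a) ≢ lucasSum (J ∷ʳ b)
last<⇒lucasSum≢ I (suc a) J b a<b ncI ¬oI _ = <⇒≢ (begin-strict
  lucasSum (I ∷ʳ suc a)  <⟨ lucasSum-< (I ∷ʳ suc a) (s≤s (s≤s z≤n)) ncI ¬oI (nc-∷ʳ-< I ncI) ⟩
  L (suc (suc a))        ≤⟨ L-mono-≤ (s≤s z≤n) a<b ⟩
  L b                    ≤⟨ L≤lucasSum-∷ʳ J b ⟩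
  lucasSum (J ∷ʳ b)      ∎)
  where open ≤-Reasoning
last<⇒lucasSum≢ I zero J b _ ncI _ ncJ with gaps≤1⇒[] I z≤n (proj₂ (nc-∷ʳ⁻ I ncI))
last<⇒lucasSum≢ _ zero J 1 _ _ _ ncJ | refl with gaps≤1⇒[] J ≤-refl (proj₂ (nc-∷ʳ⁻ J ncJ))
... | refl = λ ()
last<⇒lucasSum≢ _ zero J (suc (suc b)) _ _ _ _ | refl =
  <⇒≢ (≤-trans (L-mono-≤ {2} {suc (suc b)} (s≤s z≤n) (s≤s (s≤s z≤n))) (L≤lucasSum-∷ʳ J _))

lucasSum-injective : ∀ {I J} → NonConsec I → ¬ Opens02 I → NonConsec J → ¬ Opens02 J →
                     lucasSum I ≡ lucasSum J → I ≡ J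
lucasSum-injective {I} {J} = go (reverseView I) (reverseView J)
  where
  go : ∀ {I J} → Reverse I → Reverse J → NonConsec I → ¬ Opens02 I → NonConsec J → ¬ Opens02 J →
       lucasSum I ≡ lucasSum J → I ≡ J
  go [] [] _ _ _ _ _ = refl
  go [] (J ∶ _ ∶ʳ b) _ _ _ _ eq = contradiction eq (<⇒≢ (≤-trans (1≤L b) (L≤lucasSum-∷ʳ J b)))
  go (I ∶ _ ∶ʳ a) [] _ _ _ _ eq = contradiction (sym eq) (<⇒≢ (≤-trans (1≤L a) (L≤lucasSum-∷ʳ I a)))
  go (I ∶ rI ∶ʳ a) (J ∶ rJ ∶ʳ b) ncI ¬oI ncJ ¬oJ eq with <-cmp a b
  ... | tri< a<b _ _ = contradiction eq (last<⇒lucasSum≢ I a J b a<b ncI ¬oI ncJ)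
  ... | tri> _ _ b<a = contradiction (sym eq) (last<⇒lucasSum≢ J b I a b<a ncJ ¬oJ ncI)
  ... | tri≈ _ refl _ = cong (_∷ʳ a) (go rI rJ (proj₁ (nc-∷ʳ⁻ I ncI)) (¬oI ∘ opens02-∷ʳ a)
                                              (proj₁ (nc-∷ʳ⁻ J ncJ)) (¬oJ ∘ opens02-∷ʳ a) sumI≡sumJ)
    where
    sumI≡sumJ : lucasSum I ≡ lucasSum J
    sumI≡sumJ = +-cancelʳ-≡ (L a) _ _ (trans (sym (lucasSum-∷ʳ I a)) (trans eq (lucasSum-∷ʳ J a)))

-- Numbers with two partitions

Rep₄ : ℕ → Set
Rep₄ y = ∃[ K ] NonConsec K × All (4 ≤_) K × lucasSum K ≡ y

opens02⇒Rep₄ : ∀ {n I} → NCPartition n I → Opens02 I → ∃[ y ] n ≡ 5 + y × Rep₄ y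
opens02⇒Rep₄ (nc-∷ _ nc , refl) (opens02 K) = lucasSum K , refl , K , nc-tail nc , nc-gaps nc , refl

MultiPart⇒Rep₄ : ∀ {n} → MultiPart n → ∃[ y ] n ≡ 5 + y × Rep₄ y
MultiPart⇒Rep₄ (I , J , pI@(ncI , eI) , pJ@(ncJ , eJ) , I≢J) with opens02? I | opens02? J
... | yes oI | _ = opens02⇒Rep₄ pI oI
... | no _ | yes oJ = opens02⇒Rep₄ pJ oJ
... | no ¬oI | no ¬oJ = contradiction (lucasSum-injective ncI ¬oI ncJ ¬oJ (trans eI (sym eJ))) I≢J

carry : ∀ {o} K → NonConsec K → All (o <_) K →
        ∃[ J ] NonConsec J × All (o ≤_) J × lucasSum J ≡ L o + lucasSum K
carry {o} [] _ _ = o ∷ [] , nc-[ o ] , ≤-refl ∷ [] , refl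
carry {o} (k ∷ K) nc (o<k ∷ _) with m≤n⇒m<n∨m≡n o<k
... | inj₁ o+1<k = o ∷ k ∷ K , nc-∷ o+1<k nc , nc-lower ≤-refl (nc-∷ o+1<k nc) , refl
... | inj₂ refl with carry K (nc-tail nc) (nc-gaps nc)
...   | J , ncJ , o+2≤J , eq = J , ncJ , All.map (≤-trans (m≤n+m o 2)) o+2≤J ,
          trans eq (trans (cong (_+ lucasSum K) (+-comm (L (suc o)) (L o))) (+-assoc (L o) _ _))

Rep₄⇒MultiPart : ∀ {y} → Rep₄ y → MultiPart (5 + y)
Rep₄⇒MultiPart (K , nc , 4≤K , refl) with carry K nc 4≤K
... | J , ncJ , 3≤J , eq =
  0 ∷ 2 ∷ K , 1 ∷ J , (nc-∷ ≤-refl (nc-∷⁺ nc 4≤K) , refl) , (nc-∷⁺ ncJ 3≤J , cong suc eq) , λ ()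

Rep₄-small : ∀ {y} → y < 7 → Rep₄ y → y ≡ 0
Rep₄-small _ ([] , _ , _ , eq) = sym eq
Rep₄-small y<7 (e ∷ K , _ , 4≤e ∷ _ , refl) = contradiction (≤-trans (7≤L 4≤e) (m≤m+n _ _)) (<⇒≱ y<7)

Rep₄-L+⁻ : ∀ {m z} → z < L m → Rep₄ (L (suc m) + z) → Rep₄ z
Rep₄-L+⁻ {m} {z} z<Lm (K , nc , 4≤K , eq) = go (reverseView K) nc 4≤K eq
  where
  go : ∀ {K} → Reverse K → NonConsec K → All (4 ≤_) K → lucasSum K ≡ L (suc m) + z → Rep₄ z
  go [] _ _ eq = contradiction eq (<⇒≢ (≤-trans (1≤L (suc m)) (m≤m+n _ z)))
  go (K ∶ _ ∶ʳ e) nc 4≤Ke eq = K , proj₁ (nc-∷ʳ⁻ K nc) , proj₁ (∷ʳ⁻ 4≤Ke) , sumK≡z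
    where
    open ≤-Reasoning
    L[1+m]<L[1+e] : L (suc m) < L (suc e)
    L[1+m]<L[1+e] = begin-strict
      L (suc m)          ≤⟨ m≤m+n _ z ⟩
      L (suc m) + z      ≡⟨ sym eq ⟩
      lucasSum (K ∷ʳ e)  <⟨ lucasSum-< (K ∷ʳ e) (s≤s (≤-trans (s≤s z≤n) (proj₂ (∷ʳ⁻ 4≤Ke))))
                                       nc (high⇒¬opens02 4≤Ke) (nc-∷ʳ-< K nc) ⟩
      L (suc e)          ∎
    L[e]<L[2+m] : L e < L (suc (suc m))
    L[e]<L[2+m] = begin-strict
      L e                ≤⟨ L≤lucasSum-∷ʳ K e ⟩
      lucasSum (K ∷ʳ e)  ≡⟨ eq ⟩
      L (suc m) + z      <⟨ +-monoʳ-< (L (suc m)) z<Lm ⟩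
      L (suc (suc m))    ∎
    e≡1+m : e ≡ suc m
    e≡1+m = ≤-antisym (≤-pred (L-cancel-< (s≤s z≤n) L[e]<L[2+m]))
                      (≤-pred (L-cancel-< (s≤s z≤n) L[1+m]<L[1+e]))
    sumK≡z : lucasSum K ≡ z
    sumK≡z = +-cancelʳ-≡ (L (suc m)) _ _ (begin-equality
      lucasSum K + L (suc m)  ≡⟨ cong (λ i → lucasSum K + L i) (sym e≡1+m) ⟩
      lucasSum K + L e        ≡⟨ sym (lucasSum-∷ʳ K e) ⟩
      lucasSum (K ∷ʳ e)       ≡⟨ eq ⟩
      L (suc m) + z           ≡⟨ +-comm _ z ⟩
      z + L (suc m)           ∎)

Rep₄-L+⁺ : ∀ {m z} → 3 ≤ m → z < L m → Rep₄ z → Rep₄ (L (suc m) + z)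
Rep₄-L+⁺ {m} 3≤m z<Lm (K , nc , 4≤K , refl) =
  K ∷ʳ suc m , nc-∷ʳ⁺ nc gaps , ∷ʳ⁺ 4≤K (s≤s 3≤m) , trans (lucasSum-∷ʳ K (suc m)) (+-comm (lucasSum K) _)
  where
  gaps : All (λ e → 2 + e ≤ suc m) K
  gaps = All.map (λ Le≤z → s≤s (L-cancel-< (≤-trans (s≤s z≤n) 3≤m) (≤-<-trans Le≤z z<Lm))) (L≤lucasSum K)

Rep₄-L+ : ∀ {m z} → 3 ≤ m → z < L m → Rep₄ (L (suc m) + z) ⇔ Rep₄ z
Rep₄-L+ {m} 3≤m z<Lm = mk⇔ (Rep₄-L+⁻ {m} z<Lm) (Rep₄-L+⁺ 3≤m z<Lm)

-- Counting by the greedy split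

Unique-⊆⇒length≤ : ∀ {A : Set} {xs ys : List A} → Unique xs → (∀ {x} → x ∈ xs → x ∈ ys) → length xs ≤ length ys
Unique-⊆⇒length≤ {xs = []} _ _ = z≤n
Unique-⊆⇒length≤ {xs = x ∷ xs} (x∉xs ∷ uxs) xs⊆ys with ∈-∃++ (xs⊆ys (here refl))
... | ys₁ , ys₂ , refl = ≤-trans (s≤s (Unique-⊆⇒length≤ uxs xs⊆ys₁++ys₂))
                                 (≤-reflexive (sym (List.length-++-sucʳ ys₁ x ys₂)))
  where
  xs⊆ys₁++ys₂ : ∀ {y} → y ∈ xs → y ∈ ys₁ ++ ys₂
  xs⊆ys₁++ys₂ y∈xs with ∈-++⁻ ys₁ (xs⊆ys (there y∈xs))
  ... | inj₁ y∈ys₁ = ∈-++⁺ˡ y∈ys₁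
  ... | inj₂ (here refl) = contradiction refl (All.lookup x∉xs y∈xs)
  ... | inj₂ (there y∈ys₂) = ∈-++⁺ʳ ys₁ y∈ys₂

Unique-≈⇒length≡ : ∀ {A : Set} {xs ys : List A} → Unique xs → Unique ys → (∀ x → x ∈ xs ⇔ x ∈ ys) →
                   length xs ≡ length ys
Unique-≈⇒length≡ uxs uys xs≈ys =
  ≤-antisym (Unique-⊆⇒length≤ uxs (Equivalence.to (xs≈ys _))) (Unique-⊆⇒length≤ uys (Equivalence.from (xs≈ys _)))

EnumeratesBelow : (ℕ → Set) → ℕ → List ℕ → Set
EnumeratesBelow P x T = Unique T × (∀ y → y ∈ T ⇔ (y < x × P y))

enumeratesBelow-mono : ∀ {P x y A B} → x ≤ y → EnumeratesBelow P x A → EnumeratesBelow P y B → length A ≤ length B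
enumeratesBelow-mono x≤y (uA , A≈) (_ , B≈) = Unique-⊆⇒length≤ uA λ {z} z∈A →
  let (z<x , Pz) = Equivalence.to (A≈ z) z∈A in Equivalence.from (B≈ z) (<-≤-trans z<x x≤y , Pz)

enumeratesBelow-length : ∀ {P x A B} → EnumeratesBelow P x A → EnumeratesBelow P x B → length A ≡ length B
enumeratesBelow-length A B = ≤-antisym (enumeratesBelow-mono ≤-refl A B) (enumeratesBelow-mono ≤-refl B A)

enumeratesBelow-++ : ∀ {P a w A B} → EnumeratesBelow P a A → EnumeratesBelow P w B →
                     (∀ {z} → z < w → P (a + z) ⇔ P z) → EnumeratesBelow P (a + w) (A ++ map (a +_) B)
enumeratesBelow-++ {P} {a} {w} {A} {B} (uA , A≈) (uB , B≈) P-shift =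
  Unique.++⁺ uA (Unique.map⁺ (+-cancelˡ-≡ a _ _) uB) disjoint , λ y → mk⇔ to from
  where
  disjoint : ∀ {y} → ¬ (y ∈ A × y ∈ map (a +_) B)
  disjoint (y∈A , y∈B) with ∈-map⁻ (a +_) y∈B
  ... | z , _ , refl = <⇒≱ (proj₁ (Equivalence.to (A≈ _) y∈A)) (m≤m+n a z)
  to : ∀ {y} → y ∈ A ++ map (a +_) B → y < a + w × P y
  to y∈ with ∈-++⁻ A y∈
  ... | inj₁ y∈A = let (y<a , Py) = Equivalence.to (A≈ _) y∈A in <-≤-trans y<a (m≤m+n a w) , Py
  ... | inj₂ y∈B with ∈-map⁻ (a +_) y∈B
  ...   | z , z∈B , refl = let (z<w , Pz) = Equivalence.to (B≈ z) z∈B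
                           in +-monoʳ-< a z<w , Equivalence.from (P-shift z<w) Pz
  from : ∀ {y} → y < a + w × P y → y ∈ A ++ map (a +_) B
  from {y} (y<a+w , Py) with y <? a
  ... | yes y<a = ∈-++⁺ˡ (Equivalence.from (A≈ y) (y<a , Py))
  ... | no y≮a = subst (_∈ A ++ map (a +_) B) a+z≡y (∈-++⁺ʳ A (∈-map⁺ (a +_) (Equivalence.from (B≈ z) (z<w , Pz))))
    where
    z = y ∸ a
    a+z≡y : a + z ≡ y
    a+z≡y = m+[n∸m]≡n (≮⇒≥ y≮a)
    z<w : z < w
    z<w = +-cancelˡ-< a z w (subst (_< a + w) (sym a+z≡y) y<a+w)
    Pz : P z
    Pz = Equivalence.to (P-shift z<w) (subst P (sym a+z≡y) Py)

GreedySplit : ℕ → Set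
GreedySplit x = ∃[ m ] ∃[ w ] 3 ≤ m × 1 ≤ w × w ≤ L m × L (suc m) + w ≡ x

greedy : ∀ {x} → 7 < x → GreedySplit x
greedy {x} 7<x = search x (≤-trans (m≤n+m x 4) (n≤L (4 + x)))
  where
  split : ∀ m → 3 ≤ m → L (suc m) < x → x ≤ L (suc (suc m)) → GreedySplit x
  split m 3≤m L[1+m]<x x≤L[2+m] =
    m , x ∸ L (suc m) , 3≤m , m<n⇒0<n∸m L[1+m]<x ,
    subst (x ∸ L (suc m) ≤_) (m+n∸m≡n (L (suc m)) (L m)) (∸-monoˡ-≤ (L (suc m)) x≤L[2+m]) ,
    m+[n∸m]≡n (<⇒≤ L[1+m]<x)
  search : ∀ k → x ≤ L (4 + k) → GreedySplit x
  search zero x≤7 = contradiction x≤7 (<⇒≱ 7<x)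
  search (suc k) x≤L[5+k] with x ≤? L (4 + k)
  ... | yes x≤L[4+k] = search k x≤L[4+k]
  ... | no x≰L[4+k] = split (3 + k) (m≤m+n 3 k) (≰⇒> x≰L[4+k]) x≤L[5+k]

enumeratesBelow-Rep₄-small : ∀ {x} → 1 ≤ x → x ≤ 7 → EnumeratesBelow Rep₄ x (0 ∷ [])
enumeratesBelow-Rep₄-small 1≤x x≤7 = [] ∷ [] , λ y → mk⇔ to (from y)
  where
  to : ∀ {y} → y ∈ 0 ∷ [] → y < _ × Rep₄ y
  to (here refl) = 1≤x , [] , nc-[] , [] , refl
  from : ∀ y → y < _ × Rep₄ y → y ∈ 0 ∷ []
  from y (y<x , rep) = here (Rep₄-small (<-≤-trans y<x x≤7) rep)

-- Only the specification of the enumeration is ever used; unfolding it is expensive.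
abstract
  enumerationRep₄ : ∀ x → Σ (List ℕ) (EnumeratesBelow Rep₄ x)
  enumerationRep₄ = <-rec _ step
    where
    step : ∀ x → (∀ {y} → y < x → Σ (List ℕ) (EnumeratesBelow Rep₄ y)) → Σ (List ℕ) (EnumeratesBelow Rep₄ x)
    step zero _ = [] , [] , λ y → mk⇔ (λ ()) (λ ())
    step x@(suc _) rec with x ≤? 7
    ... | yes x≤7 = 0 ∷ [] , enumeratesBelow-Rep₄-small (s≤s z≤n) x≤7
    ... | no x≰7 with greedy (≰⇒> x≰7)
    ...   | m , w , 3≤m , 1≤w , w≤L[m] , L[1+m]+w≡x =
      subst (Σ (List ℕ) ∘ EnumeratesBelow Rep₄) L[1+m]+w≡x
        (_ , enumeratesBelow-++ (proj₂ (rec L[1+m]<x)) (proj₂ (rec w<x)) (λ z<w → Rep₄-L+ 3≤m (<-≤-trans z<w w≤L[m])))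
      where
      L[1+m]<x : L (suc m) < x
      L[1+m]<x = subst (L (suc m) <_) L[1+m]+w≡x (m<m+n (L (suc m)) 1≤w)
      w<x : w < x
      w<x = subst (w <_) L[1+m]+w≡x (m<n+m w (1≤L (suc m)))

rep₄Below : ℕ → List ℕ
rep₄Below x = proj₁ (enumerationRep₄ x)

rep₄Below-enumerates : ∀ x → EnumeratesBelow Rep₄ x (rep₄Below x)
rep₄Below-enumerates x = proj₂ (enumerationRep₄ x)

count : ℕ → ℕ
count x = length (rep₄Below x)

count≡length : ∀ {x T} → EnumeratesBelow Rep₄ x T → count x ≡ length T
count≡length = enumeratesBelow-length (rep₄Below-enumerates _)

count-mono : ∀ {x y} → x ≤ y → count x ≤ count y
count-mono x≤y = enumeratesBelow-mono x≤y (rep₄Below-enumerates _) (rep₄Below-enumerates _)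

count-split : ∀ {m w} → 3 ≤ m → w ≤ L m → count (L (suc m) + w) ≡ count (L (suc m)) + count w
count-split {m} {w} 3≤m w≤L[m] = begin
  count (L (suc m) + w)                 ≡⟨ count≡length (enumeratesBelow-++ (rep₄Below-enumerates _)
                                                                             (rep₄Below-enumerates w) translate) ⟩
  length (A ++ map (L (suc m) +_) B)    ≡⟨ List.length-++ A ⟩
  count (L (suc m)) + length (map _ B)  ≡⟨ cong (count (L (suc m)) +_) (List.length-map _ B) ⟩
  count (L (suc m)) + count w           ∎
  where
  open ≡-Reasoning
  A = rep₄Below (L (suc m))
  B = rep₄Below w
  translate : ∀ {z} → z < w → Rep₄ (L (suc m) + z) ⇔ Rep₄ z
  translate z<w = Rep₄-L+ 3≤m (<-≤-trans z<w w≤L[m])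

<∸4⇔5+≤ : ∀ {y} N → y < N ∸ 4 ⇔ 5 + y ≤ N
<∸4⇔5+≤ N = mk⇔ (to N) (∸-monoˡ-≤ 4)
  where
  to : ∀ {y} N → y < N ∸ 4 → 5 + y ≤ N
  to (suc (suc (suc (suc N)))) y<N = s≤s (s≤s (s≤s (s≤s y<N)))

length-enumerates : ∀ {N S} → Enumerates N S → length S ≡ count (N ∸ 4)
length-enumerates {N} {S} (uS , S≈) =
  trans (Unique-≈⇒length≡ uS (Unique.map⁺ (+-cancelˡ-≡ 5 _ _) uT) (λ n → mk⇔ to from)) (List.length-map (5 +_) T)
  where
  T = rep₄Below (N ∸ 4)
  uT = proj₁ (rep₄Below-enumerates (N ∸ 4))
  T≈ = proj₂ (rep₄Below-enumerates (N ∸ 4))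
  to : ∀ {n} → n ∈ S → n ∈ map (5 +_) T
  to {n} n∈S with Equivalence.to (S≈ n) n∈S
  ... | n≤N , multi with MultiPart⇒Rep₄ multi
  ...   | y , refl , rep = ∈-map⁺ (5 +_) (Equivalence.from (T≈ y) (Equivalence.from (<∸4⇔5+≤ N) n≤N , rep))
  from : ∀ {n} → n ∈ map (5 +_) T → n ∈ S
  from n∈5+T with ∈-map⁻ (5 +_) n∈5+T
  ... | y , y∈T , refl with Equivalence.to (T≈ y) y∈T
  ...   | y<N∸4 , rep = Equivalence.from (S≈ (5 + y)) (Equivalence.to (<∸4⇔5+≤ N) y<N∸4 , Rep₄⇒MultiPart rep)

G : ℕ → ℕ
G k = count (L k)

G-rec : ∀ {j} → 3 ≤ j → G (2 + j) ≡ G (1 + j) + G j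
G-rec 3≤j = count-split 3≤j ≤-refl

G₃ : G 3 ≡ 1
G₃ = count≡length (enumeratesBelow-Rep₄-small (s≤s z≤n) (s≤s (s≤s (s≤s (s≤s z≤n)))))

G₄ : G 4 ≡ 1
G₄ = count≡length (enumeratesBelow-Rep₄-small (s≤s z≤n) ≤-refl)

-- Cassini identities

-- n/D lies below the positive root of 5ρ(ρ + 1) = 1 iff Q n D < D * D.
Q : ℕ → ℕ → ℕ
Q x y = 5 * (x * (x + y))

Q-mono : ∀ {x x′ y y′} → x ≤ x′ → y ≤ y′ → Q x y ≤ Q x′ y′
Q-mono x≤x′ y≤y′ = *-monoʳ-≤ 5 (*-mono-≤ x≤x′ (+-mono-≤ x≤x′ y≤y′))

Q-scale : ∀ x y s → Q (x * s) (y * s) ≡ Q x y * (s * s)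
Q-scale = expanded
  where
  expanded : ∀ x y s → 5 * (x * s * (x * s + y * s)) ≡ 5 * (x * (x + y)) * (s * s)
  expanded = solve-∀

L≡3G+4G : ∀ i → L (4 + i) ≡ 3 * G (3 + i) + 4 * G (4 + i)
L≡3G+4G i = proj₁ (pair i)
  where
  pair : ∀ i → L (4 + i) ≡ 3 * G (3 + i) + 4 * G (4 + i) × L (5 + i) ≡ 3 * G (4 + i) + 4 * G (5 + i)
  pair zero rewrite G-rec {3} ≤-refl | G₃ | G₄ = refl , refl
  pair (suc i) with pair i
  ... | eq₀ , eq₁ = eq₁ , (begin
    L (5 + i) + L (4 + i)                                            ≡⟨ cong₂ _+_ eq₁ eq₀ ⟩
    3 * G (4 + i) + 4 * G (5 + i) + (3 * G (3 + i) + 4 * G (4 + i))  ≡⟨ regroup (G (3 + i)) (G (4 + i)) (G (5 + i)) ⟩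
    3 * (G (4 + i) + G (3 + i)) + 4 * (G (5 + i) + G (4 + i))        ≡⟨ cong₂ (λ g g′ → 3 * g + 4 * g′)
                                                                          (sym (G-rec (m≤m+n 3 i)))
                                                                          (sym (G-rec (m≤m+n 3 (suc i)))) ⟩
    3 * G (5 + i) + 4 * G (6 + i)                                    ∎)
    where
    open ≡-Reasoning
    regroup : ∀ a b c → 3 * b + 4 * c + (3 * a + 4 * b) ≡ 3 * (b + a) + 4 * (c + b)
    regroup = solve-∀

CassiniEven CassiniOdd : ℕ → ℕ → Set
CassiniEven a b = b * b + 1 ≡ a * b + a * a
CassiniOdd a b = b * b ≡ a * b + a * a + 1

cassiniEven⇒Odd : ∀ {a b} → CassiniEven a b → CassiniOdd b (b + a)
cassiniEven⇒Odd {a} {b} cassini = sym (begin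
  b * (b + a) + b * b + 1      ≡⟨ +-assoc (b * (b + a)) (b * b) 1 ⟩
  b * (b + a) + (b * b + 1)    ≡⟨ cong (b * (b + a) +_) cassini ⟩
  b * (b + a) + (a * b + a * a) ≡⟨ square-expand a b ⟩
  (b + a) * (b + a)            ∎)
  where
  open ≡-Reasoning
  square-expand : ∀ a b → b * (b + a) + (a * b + a * a) ≡ (b + a) * (b + a)
  square-expand = solve-∀

cassiniOdd⇒Even : ∀ {a b} → CassiniOdd a b → CassiniEven b (b + a)
cassiniOdd⇒Even {a} {b} cassini = sym (begin
  b * (b + a) + b * b              ≡⟨ cong (b * (b + a) +_) cassini ⟩
  b * (b + a) + (a * b + a * a + 1) ≡⟨ square-expand a b ⟩
  (b + a) * (b + a) + 1            ∎)
  where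
  open ≡-Reasoning
  square-expand : ∀ a b → b * (b + a) + (a * b + a * a + 1) ≡ (b + a) * (b + a) + 1
  square-expand = solve-∀

G-cassini : ∀ i → CassiniEven (G (3 + i * 2)) (G (4 + i * 2)) × CassiniOdd (G (4 + i * 2)) (G (5 + i * 2))
G-cassini zero = even₀ , subst (CassiniOdd (G 4)) (sym (G-rec ≤-refl)) (cassiniEven⇒Odd {G 3} even₀)
  where
  even₀ : CassiniEven (G 3) (G 4)
  even₀ rewrite G₃ | G₄ = refl
G-cassini (suc i) =
  even , subst (CassiniOdd (G (6 + i * 2))) (sym (G-rec (m≤m+n 3 (2 + i * 2)))) (cassiniEven⇒Odd {G (5 + i * 2)} even)
  where
  even : CassiniEven (G (5 + i * 2)) (G (6 + i * 2))
  even = subst (CassiniEven (G (5 + i * 2))) (sym (G-rec (m≤m+n 3 (1 + i * 2))))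
               (cassiniOdd⇒Even {G (4 + i * 2)} (proj₂ (G-cassini i)))

trade-unitʳ : ∀ {X Y c u v} → X + c * u ≡ Y + c * v → u + 1 ≡ v → X ≡ Y + c
trade-unitʳ {X} {Y} {c} {u} eq refl = +-cancelʳ-≡ (c * u) X (Y + c) (trans eq (regroup Y c u))
  where
  regroup : ∀ Y c u → Y + c * (u + 1) ≡ Y + c + c * u
  regroup = solve-∀

trade-unitˡ : ∀ {X Y c u v} → X + c * u ≡ Y + c * v → u ≡ v + 1 → X + c ≡ Y
trade-unitˡ {X} {Y} {c} {v = v} eq refl = +-cancelʳ-≡ (c * v) (X + c) Y (trans (regroup X c v) eq)
  where
  regroup : ∀ X c v → X + c + c * v ≡ X + c * (v + 1)
  regroup = solve-∀

pell-identity : ∀ a b → (3 * a + 4 * b) * (3 * a + 4 * b) + 9 * (b * b) ≡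
                        5 * (b * (b + (3 * a + 4 * b))) + 9 * (a * b + a * a)
pell-identity = solve-∀

det-identity : ∀ a b → (b + a) * (3 * a + 4 * b) + 3 * (b * b) ≡ b * (3 * b + 4 * (b + a)) + 3 * (a * b + a * a)
det-identity = solve-∀

module _ (j : ℕ) where
  private
    a = G (3 + j)
    b = G (4 + j)
    G₅≡ : G (5 + j) ≡ b + a
    G₅≡ = G-rec (m≤m+n 3 j)
    L₅≡ : L (5 + j) ≡ 3 * b + 4 * (b + a)
    L₅≡ = trans (L≡3G+4G (suc j)) (cong (λ g → 3 * b + 4 * g) G₅≡)
    open ≡-Reasoning

  pell-even : CassiniEven a b → L (4 + j) * L (4 + j) ≡ Q b (L (4 + j)) + 9
  pell-even cassini = subst (λ l → l * l ≡ Q b l + 9) (sym (L≡3G+4G j)) (trade-unitʳ (pell-identity a b) cassini)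

  pell-odd : CassiniOdd a b → L (4 + j) * L (4 + j) + 9 ≡ Q b (L (4 + j))
  pell-odd cassini = subst (λ l → l * l + 9 ≡ Q b l) (sym (L≡3G+4G j)) (trade-unitˡ (pell-identity a b) cassini)

  det-even : CassiniEven a b → G (5 + j) * L (4 + j) ≡ G (4 + j) * L (5 + j) + 3
  det-even cassini = begin
    G (5 + j) * L (4 + j)        ≡⟨ cong₂ _*_ G₅≡ (L≡3G+4G j) ⟩
    (b + a) * (3 * a + 4 * b)    ≡⟨ trade-unitʳ (det-identity a b) cassini ⟩
    b * (3 * b + 4 * (b + a)) + 3 ≡⟨ cong (λ l → b * l + 3) (sym L₅≡) ⟩
    G (4 + j) * L (5 + j) + 3    ∎

  det-odd : CassiniOdd a b → G (5 + j) * L (4 + j) + 3 ≡ G (4 + j) * L (5 + j)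
  det-odd cassini = begin
    G (5 + j) * L (4 + j) + 3    ≡⟨ cong (_+ 3) (cong₂ _*_ G₅≡ (L≡3G+4G j)) ⟩
    (b + a) * (3 * a + 4 * b) + 3 ≡⟨ trade-unitˡ (det-identity a b) cassini ⟩
    b * (3 * b + 4 * (b + a))    ≡⟨ cong (b *_) (sym L₅≡) ⟩
    G (4 + j) * L (5 + j)        ∎

-- Density bounds

FibonacciFrom : ℕ → (ℕ → ℕ) → Set
FibonacciFrom k u = ∀ {j} → k ≤ j → u (2 + j) ≡ u (1 + j) + u j

-- The mediant of two fractions lies between them.
ratio-propagates : ∀ {k u v} p q → FibonacciFrom k u → FibonacciFrom k v →
                   p * u k ≤ q * v k → p * u (suc k) ≤ q * v (suc k) → ∀ {j} → k ≤ j → p * u j ≤ q * v j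
ratio-propagates {k} {u} {v} p q u-rec v-rec at-k at-1+k {j} k≤j =
  subst (λ i → p * u i ≤ q * v i) (m∸n+n≡m k≤j) (proj₁ (pair (j ∸ k)))
  where
  pair : ∀ d → p * u (d + k) ≤ q * v (d + k) × p * u (suc d + k) ≤ q * v (suc d + k)
  pair zero = at-k , at-1+k
  pair (suc d) with pair d
  ... | at-d , at-1+d = at-1+d , (begin
    p * u (2 + (d + k))                   ≡⟨ cong (p *_) (u-rec (m≤n+m k d)) ⟩
    p * (u (1 + (d + k)) + u (d + k))     ≡⟨ *-distribˡ-+ p _ _ ⟩
    p * u (1 + (d + k)) + p * u (d + k)   ≤⟨ +-mono-≤ at-1+d at-d ⟩
    q * v (1 + (d + k)) + q * v (d + k)   ≡⟨ sym (*-distribˡ-+ q _ _) ⟩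
    q * (v (1 + (d + k)) + v (d + k))     ≡⟨ cong (q *_) (sym (v-rec (m≤n+m k d))) ⟩
    q * v (2 + (d + k))                   ∎)
    where open ≤-Reasoning

greedy-split : ∀ {k x} → 4 ≤ k → L k < x → ∃[ m ] ∃[ w ] k ≤ m × w < x × L m + w ≡ x × count x ≡ G m + count w
greedy-split {k} {x} 4≤k L[k]<x with greedy (≤-<-trans (7≤L 4≤k) L[k]<x)
... | m , w , 3≤m , 1≤w , w≤L[m] , L[1+m]+w≡x =
  suc m , w , k≤1+m , subst (w <_) L[1+m]+w≡x (m<n+m w (1≤L (suc m))) , L[1+m]+w≡x ,
  trans (cong count (sym L[1+m]+w≡x)) (count-split 3≤m w≤L[m])
  where
  k≤1+m : k ≤ suc m
  k≤1+m = ≤-pred (L-cancel-< (s≤s z≤n) (begin-strict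
    L k               <⟨ L[k]<x ⟩
    x                 ≡⟨ sym L[1+m]+w≡x ⟩
    L (suc m) + w     ≤⟨ +-monoʳ-≤ (L (suc m)) w≤L[m] ⟩
    L (suc (suc m))   ∎))
    where open ≤-Reasoning

count-lower : ∀ {k p q} → 4 ≤ k → (∀ {j} → k ≤ j → p * L j ≤ q * G j) →
              ∀ x → p * x ≤ q * count x + p * L k
count-lower {k} {p} {q} 4≤k ratio = <-rec _ step
  where
  step : ∀ x → (∀ {y} → y < x → p * y ≤ q * count y + p * L k) → p * x ≤ q * count x + p * L k
  step x rec with x ≤? L k
  ... | yes x≤L[k] = ≤-trans (*-monoʳ-≤ p x≤L[k]) (m≤n+m _ _)
  ... | no x≰L[k] with greedy-split 4≤k (≰⇒> x≰L[k])
  ...   | m , w , k≤m , w<x , refl , count≡ = begin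
    p * (L m + w)                      ≡⟨ *-distribˡ-+ p (L m) w ⟩
    p * L m + p * w                    ≤⟨ +-mono-≤ (ratio k≤m) (rec w<x) ⟩
    q * G m + (q * count w + p * L k)  ≡⟨ sym (+-assoc (q * G m) _ _) ⟩
    q * G m + q * count w + p * L k    ≡⟨ cong (_+ p * L k) (sym (*-distribˡ-+ q _ _)) ⟩
    q * (G m + count w) + p * L k      ≡⟨ cong (λ c → q * c + p * L k) (sym count≡) ⟩
    q * count (L m + w) + p * L k      ∎
    where open ≤-Reasoning

count-upper : ∀ {k p q} → 4 ≤ k → (∀ {j} → k ≤ j → q * G j ≤ p * L j) →
              ∀ x → q * count x ≤ p * x + q * G k
count-upper {k} {p} {q} 4≤k ratio = <-rec _ step
  where
  step : ∀ x → (∀ {y} → y < x → q * count y ≤ p * y + q * G k) → q * count x ≤ p * x + q * G k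
  step x rec with x ≤? L k
  ... | yes x≤L[k] = ≤-trans (*-monoʳ-≤ q (count-mono x≤L[k])) (m≤n+m _ _)
  ... | no x≰L[k] with greedy-split 4≤k (≰⇒> x≰L[k])
  ...   | m , w , k≤m , w<x , refl , count≡ = begin
    q * count (L m + w)                ≡⟨ cong (q *_) count≡ ⟩
    q * (G m + count w)                ≡⟨ *-distribˡ-+ q _ _ ⟩
    q * G m + q * count w              ≤⟨ +-mono-≤ (ratio k≤m) (rec w<x) ⟩
    p * L m + (p * w + q * G k)        ≡⟨ sym (+-assoc (p * L m) _ _) ⟩
    p * L m + p * w + q * G k          ≡⟨ cong (_+ q * G k) (sym (*-distribˡ-+ p _ _)) ⟩
    p * (L m + w) + q * G k            ∎
    where open ≤-Reasoning

+9-scale : ∀ x D → (x + 9) * (D * D) ≡ x * (D * D) + 3 * D * (3 * D)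
+9-scale = solve-∀

m*n+m≡m*[1+n] : ∀ x y → x * y + x ≡ x * suc y
m*n+m≡m*[1+n] x y = trans (+-comm (x * y) x) (sym (*-suc x y))

below-root⇒< : ∀ {n D g l} → Q n D < D * D → l * l ≡ Q g l + 9 → 3 * D < l → n * l < g * D
below-root⇒< {n} {D} {g} {l} root pell 3D<l with n * l <? g * D
... | yes nl<gD = nl<gD
... | no nl≮gD = contradiction (*-mono-< 3D<l 3D<l) (≤⇒≯ (+-cancelˡ-≤ (l * l * Q n D) _ _ (begin
  l * l * Q n D + l * l            ≡⟨ m*n+m≡m*[1+n] (l * l) (Q n D) ⟩
  l * l * suc (Q n D)              ≤⟨ *-monoʳ-≤ (l * l) root ⟩
  l * l * (D * D)                  ≡⟨ cong (_* (D * D)) pell ⟩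
  (Q g l + 9) * (D * D)            ≡⟨ +9-scale (Q g l) D ⟩
  Q g l * (D * D) + 3 * D * (3 * D) ≡⟨ cong (_+ 3 * D * (3 * D)) (sym (Q-scale g l D)) ⟩
  Q (g * D) (l * D) + 3 * D * (3 * D) ≤⟨ +-monoˡ-≤ _ (Q-mono (≮⇒≥ nl≮gD) (≤-reflexive (*-comm l D))) ⟩
  Q (n * l) (D * l) + 3 * D * (3 * D) ≡⟨ cong (_+ 3 * D * (3 * D)) (trans (Q-scale n D l) (*-comm (Q n D) (l * l))) ⟩
  l * l * Q n D + 3 * D * (3 * D)  ∎)))
  where open ≤-Reasoning

above-root⇒< : ∀ {n D g l} → D * D < Q n D → l * l + 9 ≡ Q g l → 3 * D < l → g * D < n * l
above-root⇒< {n} {D} {g} {l} root pell 3D<l with g * D <? n * l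
... | yes gD<nl = gD<nl
... | no gD≮nl = contradiction (*-mono-< 3D<l 3D<l) (≤⇒≯ (+-cancelˡ-≤ (l * l * (D * D)) _ _ (begin
  l * l * (D * D) + l * l          ≡⟨ m*n+m≡m*[1+n] (l * l) (D * D) ⟩
  l * l * suc (D * D)              ≤⟨ *-monoʳ-≤ (l * l) root ⟩
  l * l * Q n D                    ≡⟨ trans (*-comm (l * l) (Q n D)) (sym (Q-scale n D l)) ⟩
  Q (n * l) (D * l)                ≤⟨ Q-mono (≮⇒≥ gD≮nl) (≤-reflexive (*-comm D l)) ⟩
  Q (g * D) (l * D)                ≡⟨ Q-scale g l D ⟩
  Q g l * (D * D)                  ≡⟨ cong (_* (D * D)) (sym pell) ⟩
  (l * l + 9) * (D * D)            ≡⟨ +9-scale (l * l) D ⟩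
  l * l * (D * D) + 3 * D * (3 * D) ∎)))
  where open ≤-Reasoning

eventually-above : ∀ {n D p q r c x} → n * q < p * D → p * x ≤ q * c + p * r →
                   D * (p * r) + 4 * (n * q) < x → n * (x + 4) < c * D
eventually-above {n} {D} {p} {q} {r} {c} {x} cut lower large =
  *-cancelˡ-< q _ _ (+-cancelʳ-< (D * (p * r)) _ _ (begin-strict
    q * (n * (x + 4)) + D * (p * r)       ≡⟨ regroup₁ n q x D p r ⟩
    n * q * x + (D * (p * r) + 4 * (n * q)) <⟨ +-monoʳ-< (n * q * x) large ⟩
    n * q * x + x                         ≡⟨ +-comm (n * q * x) x ⟩
    suc (n * q) * x                       ≤⟨ *-monoˡ-≤ x cut ⟩
    p * D * x                             ≡⟨ regroup₂ p D x ⟩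
    D * (p * x)                           ≤⟨ *-monoʳ-≤ D lower ⟩
    D * (q * c + p * r)                   ≡⟨ regroup₃ D q c p r ⟩
    q * (c * D) + D * (p * r)             ∎))
  where
  open ≤-Reasoning
  regroup₁ : ∀ n q x D p r → q * (n * (x + 4)) + D * (p * r) ≡ n * q * x + (D * (p * r) + 4 * (n * q))
  regroup₁ = solve-∀
  regroup₂ : ∀ p D x → p * D * x ≡ D * (p * x)
  regroup₂ = solve-∀
  regroup₃ : ∀ D q c p r → D * (q * c + p * r) ≡ q * (c * D) + D * (p * r)
  regroup₃ = solve-∀

eventually-below : ∀ {n D p q r c x} → p * D < n * q → q * c ≤ p * x + q * r →
                   D * (q * r) < x → c * D < n * (x + 4)
eventually-below {n} {D} {p} {q} {r} {c} {x} cut upper large =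
  *-cancelˡ-< q _ _ (begin-strict
    q * (c * D)                   ≡⟨ regroup₁ q c D ⟩
    D * (q * c)                   ≤⟨ *-monoʳ-≤ D upper ⟩
    D * (p * x + q * r)           ≡⟨ regroup₂ D p x q r ⟩
    D * p * x + D * (q * r)       <⟨ +-monoʳ-< (D * p * x) large ⟩
    D * p * x + x                 ≡⟨ +-comm (D * p * x) x ⟩
    suc (D * p) * x               ≤⟨ *-monoˡ-≤ x (subst (λ t → suc t ≤ n * q) (*-comm p D) cut) ⟩
    n * q * x                     ≤⟨ m≤m+n (n * q * x) (4 * (n * q)) ⟩
    n * q * x + 4 * (n * q)       ≡⟨ regroup₃ n q x ⟩
    q * (n * (x + 4))             ∎)
  where
  open ≤-Reasoning
  regroup₁ : ∀ q c D → q * (c * D) ≡ D * (q * c)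
  regroup₁ = solve-∀
  regroup₂ : ∀ D p x q r → D * (p * x + q * r) ≡ D * p * x + D * (q * r)
  regroup₂ = solve-∀
  regroup₃ : ∀ n q x → n * q * x + 4 * (n * q) ≡ q * (n * (x + 4))
  regroup₃ = solve-∀

3D<L : ∀ D k → 3 * D < L (suc k + 3 * D * 2)
3D<L D k = ≤-trans (s≤s (≤-trans (m≤m*n (3 * D) 2) (m≤n+m _ k))) (n≤L _)

G-fibonacci : ∀ {k} → 3 ≤ k → FibonacciFrom k G
G-fibonacci 3≤k k≤j = G-rec (≤-trans 3≤k k≤j)

count-eventually-above : ∀ {n D} → Q n D < D * D → ∃[ X ] (∀ {x} → X < x → n * (x + 4) < count x * D)
count-eventually-above {n} {D} root =
  D * (G k * L k) + 4 * (n * L k) ,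
  λ {x} → eventually-above {n} {D} {G k} {L k} {L k} {count x} cut (count-lower {p = G k} {L k} 4≤k ratio x)
  where
  i = 3 * D
  k = 4 + i * 2
  4≤k : 4 ≤ k
  4≤k = m≤m+n 4 (i * 2)
  cassini = proj₁ (G-cassini i)
  cut : n * L k < G k * D
  cut = below-root⇒< {n} {D} {G k} {L k} root (pell-even (i * 2) cassini) (3D<L D 3)
  at-1+k : G k * L (suc k) ≤ L k * G (suc k)
  at-1+k = ≤-trans (m≤m+n _ 3) (≤-reflexive (trans (sym (det-even (i * 2) cassini)) (*-comm (G (suc k)) (L k))))
  ratio : ∀ {j} → k ≤ j → G k * L j ≤ L k * G j
  ratio = ratio-propagates {k} {L} {G} (G k) (L k) (λ _ → refl) (G-fibonacci (≤-trans (n≤1+n 3) 4≤k))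
                           (≤-reflexive (*-comm (G k) (L k))) at-1+k

count-eventually-below : ∀ {n D} → D * D < Q n D → ∃[ X ] (∀ {x} → X < x → count x * D < n * (x + 4))
count-eventually-below {n} {D} root =
  D * (L k * G k) ,
  λ {x} → eventually-below {n} {D} {G k} {L k} {G k} {count x} cut (count-upper {p = G k} {L k} 4≤k ratio x)
  where
  i = 3 * D
  k = 5 + i * 2
  4≤k : 4 ≤ k
  4≤k = m≤m+n 4 (suc (i * 2))
  cassini = proj₂ (G-cassini i)
  cut : G k * D < n * L k
  cut = above-root⇒< {n} {D} {G k} {L k} root (pell-odd (suc (i * 2)) cassini) (3D<L D 4)
  at-1+k : L k * G (suc k) ≤ G k * L (suc k)
  at-1+k = ≤-trans (≤-reflexive (*-comm (L k) (G (suc k))))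
                   (≤-trans (m≤m+n _ 3) (≤-reflexive (det-odd (suc (i * 2)) cassini)))
  ratio : ∀ {j} → k ≤ j → L k * G j ≤ G k * L j
  ratio = ratio-propagates {k} {G} {L} (L k) (G k) (G-fibonacci (≤-trans (n≤1+n 3) 4≤k)) (λ _ → refl)
                           (≤-reflexive (*-comm (L k) (G k))) at-1+k

-- Rational arithmetic

-- Imported only here: in scope earlier, +_ would make sections such as (a +_) ambiguous.
open import Data.Integer using (+_)

shift-numerator : ℚ → ℤ
shift-numerator q = + 10 ℤ.* ↥ q ℤ.+ + 5 ℤ.* ↧ q

shiftᵘ : ℚ → ℚᵘ
shiftᵘ q = mkℚᵘ (shift-numerator q) (ℚ.denominator-1 q)

toℚᵘ-shift : ∀ q → toℚᵘ (shift q) ℚᵘ.≃ shiftᵘ q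
toℚᵘ-shift q@(mkℚ n d _) = ℚᵘ.≃-trans (toℚᵘ-homo-+ (+ 10 / 1 ℚ.* q) (+ 5 / 1))
  (ℚᵘ.≃-trans (ℚᵘ.+-congˡ (mkℚᵘ (+ 5) 0) (toℚᵘ-homo-* (+ 10 / 1) q))
              (*≡* (cong₂ ℤ._*_ numerator≡ (sym denominator≡))))
  where
  X = mkℚᵘ (+ 10) 0 ℚᵘ.* mkℚᵘ n d ℚᵘ.+ mkℚᵘ (+ 5) 0
  numerator≡ : ℚᵘ.↥ X ≡ shift-numerator q
  numerator≡ = cong₂ ℤ._+_ (ℤ.*-identityʳ (+ 10 ℤ.* n)) (cong (λ z → + 5 ℤ.* + z) (*-identityˡ (suc d)))
  denominator≡ : ℚᵘ.↧ X ≡ ↧ q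
  denominator≡ = cong +_ (trans (*-identityʳ _) (*-identityˡ (suc d)))

toℚᵘ-shift² : ∀ q → toℚᵘ (shift q ℚ.* shift q) ℚᵘ.≃ shiftᵘ q ℚᵘ.* shiftᵘ q
toℚᵘ-shift² q = ℚᵘ.≃-trans (toℚᵘ-homo-* (shift q) (shift q)) (ℚᵘ.*-cong (toℚᵘ-shift q) (toℚᵘ-shift q))

shift<0⇒ : ∀ q → shift q ℚ.< 0ℚ → shift-numerator q ℤ.< + 0
shift<0⇒ q shift<0 with ℚᵘ.<-respˡ-≃ (toℚᵘ-shift q) (toℚᵘ-mono-< shift<0)
... | *<* lt = subst (ℤ._< + 0) (ℤ.*-identityʳ _) lt

0<shift⇒ : ∀ q → 0ℚ ℚ.< shift q → + 0 ℤ.< shift-numerator q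
0<shift⇒ q 0<shift with ℚᵘ.<-respʳ-≃ (toℚᵘ-shift q) (toℚᵘ-mono-< 0<shift)
... | *<* lt = subst (+ 0 ℤ.<_) (ℤ.*-identityʳ _) lt

shift²<45⇒ : ∀ q → shift q ℚ.* shift q ℚ.< + 45 / 1 →
             shift-numerator q ℤ.* shift-numerator q ℤ.< + (45 * (↧ₙ q * ↧ₙ q))
shift²<45⇒ q lt with ℚᵘ.<-respˡ-≃ (toℚᵘ-shift² q) (toℚᵘ-mono-< lt)
... | *<* lt = subst₂ ℤ._<_ (ℤ.*-identityʳ _) (sym (ℤ.pos-* 45 (↧ₙ q * ↧ₙ q))) lt

45<shift²⇒ : ∀ q → + 45 / 1 ℚ.< shift q ℚ.* shift q →
             + (45 * (↧ₙ q * ↧ₙ q)) ℤ.< shift-numerator q ℤ.* shift-numerator q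
45<shift²⇒ q lt with ℚᵘ.<-respʳ-≃ (toℚᵘ-shift² q) (toℚᵘ-mono-< lt)
... | *<* lt = subst₂ ℤ._<_ (sym (ℤ.pos-* 45 (↧ₙ q * ↧ₙ q))) (ℤ.*-identityʳ _) lt

shift-numerator-+ : ∀ {q n} → ↥ q ≡ + n → shift-numerator q ≡ + (10 * n + 5 * ↧ₙ q)
shift-numerator-+ {q} {n} ↥q≡n = trans (cong (λ z → + 10 ℤ.* z ℤ.+ + 5 ℤ.* ↧ q) ↥q≡n)
  (sym (trans (ℤ.pos-+ (10 * n) (5 * ↧ₙ q)) (cong₂ ℤ._+_ (ℤ.pos-* 10 n) (ℤ.pos-* 5 (↧ₙ q)))))

shift-numerator--[1+] : ∀ {q k} → ↥ q ≡ -[1+ k ] → shift-numerator q ℤ.+ + (10 * suc k) ≡ + (5 * ↧ₙ q)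
shift-numerator--[1+] {q} {k} ↥q≡-[1+k] = begin
  shift-numerator q ℤ.+ + (10 * suc k)                           ≡⟨ cong₂ (λ z z′ → + 10 ℤ.* z ℤ.+ + 5 ℤ.* ↧ q ℤ.+ z′)
                                                                       ↥q≡-[1+k] (ℤ.pos-* 10 (suc k)) ⟩
  + 10 ℤ.* ℤ.- + suc k ℤ.+ + 5 ℤ.* ↧ q ℤ.+ + 10 ℤ.* + suc k       ≡⟨ cancel (+ suc k) (+ 5 ℤ.* ↧ q) ⟩
  + 5 ℤ.* ↧ q                                                     ≡⟨ sym (ℤ.pos-* 5 (↧ₙ q)) ⟩
  + (5 * ↧ₙ q)                                                    ∎
  where
  open ≡-Reasoning
  cancel : ∀ x y → + 10 ℤ.* ℤ.- x ℤ.+ y ℤ.+ + 10 ℤ.* x ≡ y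
  cancel = ℤ.solve-∀

shift²≡ : ∀ n D → (10 * n + 5 * D) * (10 * n + 5 * D) ≡ 20 * Q n D + 25 * (D * D)
shift²≡ = expanded
  where
  expanded : ∀ n D → (10 * n + 5 * D) * (10 * n + 5 * D) ≡ 20 * (5 * (n * (n + D))) + 25 * (D * D)
  expanded = solve-∀

squared-below⇒Q< : ∀ {n D} → (10 * n + 5 * D) * (10 * n + 5 * D) < 45 * (D * D) → Q n D < D * D
squared-below⇒Q< {n} {D} lt =
  *-cancelˡ-< 20 _ _ (+-cancelʳ-< (25 * (D * D)) _ _ (subst₂ _<_ (shift²≡ n D) (*-distribʳ-+ (D * D) 20 25) lt))

squared-above⇒<Q : ∀ {n D} → 45 * (D * D) < (10 * n + 5 * D) * (10 * n + 5 * D) → D * D < Q n D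
squared-above⇒<Q {n} {D} lt =
  *-cancelˡ-< 20 _ _ (+-cancelʳ-< (25 * (D * D)) _ _ (subst₂ _<_ (*-distribʳ-+ (D * D) 20 25) (shift²≡ n D) lt))

shift-numerator² : ∀ {q n} → ↥ q ≡ + n →
                   shift-numerator q ℤ.* shift-numerator q ≡ + ((10 * n + 5 * ↧ₙ q) * (10 * n + 5 * ↧ₙ q))
shift-numerator² {q} {n} ↥q≡n =
  trans (cong₂ ℤ._*_ (shift-numerator-+ {q} ↥q≡n) (shift-numerator-+ {q} ↥q≡n)) (sym (ℤ.pos-* N N))
  where
  N = 10 * n + 5 * ↧ₙ q

belowTarget⇒Q< : ∀ {q n} → ↥ q ≡ + n → BelowTarget q → Q n (↧ₙ q) < ↧ₙ q * ↧ₙ q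
belowTarget⇒Q< {q} ↥q≡n (inj₁ shift<0) with subst (ℤ._< + 0) (shift-numerator-+ {q} ↥q≡n) (shift<0⇒ q shift<0)
... | +<+ ()
belowTarget⇒Q< {q} {n} ↥q≡n (inj₂ shift²<45) =
  squared-below⇒Q< {n} {↧ₙ q}
    (ℤ.drop‿+<+ (subst (ℤ._< + (45 * (↧ₙ q * ↧ₙ q))) (shift-numerator² {q} ↥q≡n) (shift²<45⇒ q shift²<45)))

aboveTarget⇒<Q : ∀ {q n} → ↥ q ≡ + n → AboveTarget q → ↧ₙ q * ↧ₙ q < Q n (↧ₙ q)
aboveTarget⇒<Q {q} {n} ↥q≡n (_ , 45<shift²) =
  squared-above⇒<Q {n} {↧ₙ q}
    (ℤ.drop‿+<+ (subst (+ (45 * (↧ₙ q * ↧ₙ q)) ℤ.<_) (shift-numerator² {q} ↥q≡n) (45<shift²⇒ q 45<shift²)))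

-- For b < 0 the numerator of 10 b + 5 is at most 5 D, too small for (10 b + 5)² > 45.
no-large-square : ∀ {t P D} → t ℤ.+ + P ≡ + (5 * D) → + 0 ℤ.< t → + (45 * (D * D)) ℤ.< t ℤ.* t → ⊥
no-large-square {+ m} {P} {D} m+P≡5D _ lt = <⇒≱ (ℤ.drop‿+<+ (subst (_ ℤ.<_) (sym (ℤ.pos-* m m)) lt)) (begin
  m * m              ≤⟨ *-mono-≤ m≤5D m≤5D ⟩
  5 * D * (5 * D)    ≡⟨ regroup D ⟩
  25 * (D * D)       ≤⟨ *-monoˡ-≤ (D * D) (m≤m+n 25 20) ⟩
  45 * (D * D)       ∎)
  where
  open ≤-Reasoning
  m≤5D : m ≤ 5 * D
  m≤5D = subst (m ≤_) (ℤ.+-injective (trans (ℤ.pos-+ m P) m+P≡5D)) (m≤m+n m P)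
  regroup : ∀ D → 5 * D * (5 * D) ≡ 25 * (D * D)
  regroup = solve-∀

¬aboveTarget-negative : ∀ {q k} → ↥ q ≡ -[1+ k ] → ¬ AboveTarget q
¬aboveTarget-negative {q} ↥q≡-[1+k] (0<shift , 45<shift²) =
  no-large-square {D = ↧ₙ q} (shift-numerator--[1+] {q} ↥q≡-[1+k]) (0<shift⇒ q 0<shift) (45<shift²⇒ q 45<shift²)

<-/ : ∀ {q c M} → ↥ q ℤ.* + suc M ℤ.< + c ℤ.* ↧ q → q ℚ.< + c / suc M
<-/ {mkℚ _ _ _} {c} {M} lt = toℚᵘ-cancel-< (ℚᵘ.<-respʳ-≃ (ℚᵘ.≃-sym (toℚᵘ-fromℚᵘ (mkℚᵘ (+ c) M))) (*<* lt))

/-< : ∀ {q c M} → + c ℤ.* ↧ q ℤ.< ↥ q ℤ.* + suc M → + c / suc M ℚ.< q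
/-< {mkℚ _ _ _} {c} {M} lt = toℚᵘ-cancel-< (ℚᵘ.<-respˡ-≃ (ℚᵘ.≃-sym (toℚᵘ-fromℚᵘ (mkℚᵘ (+ c) M))) (*<* lt))

pos-*-< : ∀ a b c d → a * b < c * d → + a ℤ.* + b ℤ.< + c ℤ.* + d
pos-*-< a b c d lt = subst₂ ℤ._<_ (ℤ.pos-* a b) (ℤ.pos-* c d) (+<+ lt)

at-suc : ∀ {X} (P : ℕ → ℕ → Set) → (∀ {x} → X < x → P x (x + 4)) → ∀ {M} → X + 4 ≤ M → P (suc M ∸ 4) (suc M)
at-suc {X} P P-eventually {M} X+4≤M =
  subst (P (suc M ∸ 4)) (m∸n+n≡m (≤-trans (m≤n+m 4 X) (≤-trans X+4≤M (n≤1+n M))))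
        (P-eventually (m+n≤o⇒m≤o∸n (suc X) (s≤s X+4≤M)))

lower-limit : ∀ a → BelowTarget a → ∃[ M₀ ] (∀ M → M₀ ≤ M → a ℚ.< + count (suc M ∸ 4) / suc M)
lower-limit a@(mkℚ -[1+ k ] d _) _ = 0 , λ M _ →
  <-/ {a} {count (suc M ∸ 4)} {M} (subst (-[1+ k ] ℤ.* + suc M ℤ.<_) (ℤ.pos-* (count (suc M ∸ 4)) (suc d)) -<+)
lower-limit a@(mkℚ (+ n) d _) a<θ = X + 4 , λ M X+4≤M →
  <-/ {a} {count (suc M ∸ 4)} {M}
      (pos-*-< n (suc M) (count (suc M ∸ 4)) (suc d) (at-suc (λ x N → n * N < count x * suc d) above X+4≤M))
  where
  X = proj₁ (count-eventually-above {n} {suc d} (belowTarget⇒Q< {a} {n} refl a<θ))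
  above = proj₂ (count-eventually-above {n} {suc d} (belowTarget⇒Q< {a} {n} refl a<θ))

upper-limit : ∀ b → AboveTarget b → ∃[ M₀ ] (∀ M → M₀ ≤ M → + count (suc M ∸ 4) / suc M ℚ.< b)
upper-limit b@(mkℚ -[1+ _ ] _ _) θ<b = contradiction θ<b (¬aboveTarget-negative {b} refl)
upper-limit b@(mkℚ (+ n) d _) θ<b = X + 4 , λ M X+4≤M →
  /-< {b} {count (suc M ∸ 4)} {M}
      (pos-*-< (count (suc M ∸ 4)) (suc d) n (suc M) (at-suc (λ x N → count x * suc d < n * N) below X+4≤M))
  where
  X = proj₁ (count-eventually-below {n} {suc d} (aboveTarget⇒<Q {b} {n} refl θ<b))
  below = proj₂ (count-eventually-below {n} {suc d} (aboveTarget⇒<Q {b} {n} refl θ<b))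

theorem1p5 : (a b : ℚ) → BelowTarget a → AboveTarget b →
    ∃[ M₀ ] ((M : ℕ) → M₀ ≤ M → (S : List ℕ) → Enumerates (suc M) S →
      (a ℚ.< (+ length S) / suc M) × ((+ length S) / suc M ℚ.< b))
theorem1p5 a b a<θ θ<b = M₁ + M₂ , λ M M₁+M₂≤M S S-enumerates →
  subst (λ c → (a ℚ.< (+ c) / suc M) × ((+ c) / suc M ℚ.< b)) (sym (length-enumerates S-enumerates))
        (above M (≤-trans (m≤m+n M₁ M₂) M₁+M₂≤M) , below M (≤-trans (m≤n+m M₂ M₁) M₁+M₂≤M))
  where
  M₁ = proj₁ (lower-limit a a<θ)
  above = proj₂ (lower-limit a a<θ)
  M₂ = proj₁ (upper-limit b θ<b)
  below = proj₂ (upper-limit b θ<b)
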